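{- Let $R_q(k,s)$ be the number of solutions $(Y_1,Z_1,U_1,V_1,\ldots,Y_q,Z_q,U_q,V_q)$ in $\mathbb{F}_2[T]$ of \[\begin{cases} Y_1Z_1+\cdots+Y_qZ_q=0,\\ Y_1U_1+\cdots+Y_qU_q=0,\\ Y_1V_1+\cdots+Y_qV_q=0,\end{cases}\] with $\deg Y_i\leq k-1$, $\deg Z_i\leq s-1$, $\deg U_i\leq s-1$, $\deg V_i\leq s-1$ for $1\leq i\leq q$. Then $$R_q(k,s) = \int_{\mathbb{P}\times\mathbb{P}\times\mathbb{P}} g_{k,s}^{q}(t,\eta,\xi)\,dt\,d\eta\,d\xi = 2^{(3s+k)q}\cdot 2^{ -3k-3s+3}\cdot\sum_{i=0}^{\inf(3s,k)}\Gamma_{i}^{\left[s\atop{s\atop s}\right]\times k}\cdot 2^{ -qi}.$$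
   Context: $\mathbb{K}=\mathbb{F}_2((T^{ -1}))$, $\mathbb{P}$ its unit interval with normalized Haar measure, $E$ the additive character of $\mathbb{K}$ ($E(\sum a_iT^i)=(-1)^{a_{ -1}}$), and $g_{k,s}(t,\eta,\xi)=\sum_{\deg Y\leq k-1}\sum_{\deg Z\leq s-1}E(tYZ)\sum_{\deg U\leq s-1}E(\eta YU)\sum_{\deg V\leq s-1}E(\xi YV)$. $\Gamma_{i}^{\left[s\atop{s\atop s}\right]\times k}$ is the number of rank $i$ matrices $\left[\frac{A}{\frac{B}{C}}\right]$ over $\mathbb{F}_2$ with $A,B,C$ all $s\times k$ persymmetric matrices. -}

module Defs where

open import Data.Bool using (Bool; true; false; _xor_; _∧_; if_then_else_)
open import Data.Nat as ℕ using (ℕ; zero; suc; _+_; _*_; _∸_; _≡ᵇ_)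
open import Data.Fin using (Fin; toℕ)
open import Data.List as List using (List; []; _∷_; map; concatMap; foldr; _++_)
open import Data.Vec as Vec using (Vec; []; _∷_; toList; tabulate; head; tail)
open import Data.Maybe using (Maybe; just; nothing)
open import Data.Product using (_×_; _,_)
open import Data.Integer as ℤ using (ℤ; +_; -[1+_])
open import Data.Rational as ℚ using (ℚ; ½; 1ℚ)

vecsOf : {A : Set} → List A → (n : ℕ) → List (Vec A n)
vecsOf xs zero    = [] ∷ []
vecsOf xs (suc n) = concatMap (λ v → map (λ x → x ∷ v) xs) (vecsOf xs n)

bools : List Bool
bools = false ∷ true ∷ []

allVecs : (n : ℕ) → List (Vec Bool n)
allVecs = vecsOf bools

count : {A : Set} → (A → Bool) → List A → ℕ
count f = foldr (λ x n → if f x then suc n else n) 0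

sumℤ : {A : Set} → (A → ℤ) → List A → ℤ
sumℤ f = foldr (λ x acc → f x ℤ.+ acc) (+ 0)

sumℚ : {A : Set} → (A → ℚ) → List A → ℚ
sumℚ f = foldr (λ x acc → f x ℚ.+ acc) (ℚ.0ℚ)

powℚ : ℚ → ℕ → ℚ
powℚ x zero    = 1ℚ
powℚ x (suc n) = x ℚ.* powℚ x n

ℕtoℚ : ℕ → ℚ
ℕtoℚ n = + n ℚ./ 1

-- Polynomials in F_2[T] as coefficient lists (constant term first).
-- A polynomial of degree ≤ n-1 is a  Vec Bool n  (n = 0: only the zero polynomial).

Poly : Set
Poly = List Bool

_⊕_ : Poly → Poly → Poly
[]      ⊕ q       = q
(a ∷ p) ⊕ []      = a ∷ p
(a ∷ p) ⊕ (b ∷ q) = (a xor b) ∷ (p ⊕ q)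

_⊗_ : Poly → Poly → Poly
[]      ⊗ q = []
(a ∷ p) ⊗ q = map (a ∧_) q ⊕ (false ∷ (p ⊗ q))

isZero : Poly → Bool
isZero = foldr (λ b acc → if b then false else acc) true

poly : {n : ℕ} → Vec Bool n → Poly
poly = toList

Quad : ℕ → ℕ → Set
Quad k s = Vec Bool k × Vec Bool s × Vec Bool s × Vec Bool s

allQuads : (k s : ℕ) → List (Quad k s)
allQuads k s =
  concatMap (λ y → concatMap (λ z → concatMap (λ u → map (λ v → y , z , u , v)
    (allVecs s)) (allVecs s)) (allVecs s)) (allVecs k)

sums : {k s q : ℕ} → Vec (Quad k s) q → Poly × Poly × Poly
sums []                   = [] , [] , []
sums ((y , z , u , v) ∷ w) with sums w
... | a , b , c = (poly y ⊗ poly z) ⊕ a , (poly y ⊗ poly u) ⊕ b , (poly y ⊗ poly v) ⊕ c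

isSolution : {k s q : ℕ} → Vec (Quad k s) q → Bool
isSolution w with sums w
... | a , b , c = isZero a ∧ (isZero b ∧ isZero c)

R : (q k s : ℕ) → ℕ
R q k s = count isSolution (vecsOf (allQuads k s) q)

-- Elements of the unit interval P = { x ∈ F_2((T^{-1})) : deg x < 0 } are given by
-- their digit sequences: t j = coefficient of T^{-(j+1)}.

𝕡 : Set
𝕡 = ℕ → Bool

-- coefficient of T^{-1} in t·P  (= Σ_m t_{-(m+1)} p_m  over F_2)
coeffM1 : 𝕡 → Poly → Bool
coeffM1 t p = go 0 p
  where
  go : ℕ → Poly → Bool
  go m []      = false
  go m (b ∷ p) = (t m ∧ b) xor go (suc m) p

E : 𝕡 → Poly → ℤ
E t p = if coeffM1 t p then -[1+ 0 ] else + 1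

g : (k s : ℕ) → 𝕡 → 𝕡 → 𝕡 → ℤ
g k s t η ξ = sumℤ (λ Y →
    sumℤ (λ Z → E t (poly Y ⊗ poly Z)) (allVecs s)
    ℤ.* (sumℤ (λ U → E η (poly Y ⊗ poly U)) (allVecs s)
    ℤ.* sumℤ (λ V → E ξ (poly Y ⊗ poly V)) (allVecs s)))
  (allVecs k)

extend : {N : ℕ} → Vec Bool N → 𝕡
extend []      j       = false
extend (b ∷ v) zero    = b
extend (b ∷ v) (suc j) = extend v j

-- Haar integral over P×P×P of a function depending only on the first N digits of
-- each argument (average over the 2^{3N} cylinder sets).
integral3 : (N : ℕ) → (𝕡 → 𝕡 → 𝕡 → ℤ) → ℚ
integral3 N f =
  powℚ ½ (3 * N) ℚ.*
  (sumℤ (λ a → sumℤ (λ b → sumℤ (λ c → f (extend a) (extend b) (extend c))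
     (allVecs N)) (allVecs N)) (allVecs N) ℚ./ 1)

pick : {n : ℕ} → List (Vec Bool (suc n)) → Maybe (Vec Bool n × List (Vec Bool (suc n)))
pick []      = nothing
pick (r ∷ rs) with head r | pick rs
... | true  | _                 = just (tail r , rs)
... | false | nothing           = nothing
... | false | just (p , rest)   = just (p , r ∷ rest)

rank : {n : ℕ} → List (Vec Bool n) → ℕ
rank {zero}  rows = 0
rank {suc n} rows with pick rows
... | nothing         = rank (map tail rows)
... | just (p , rest) = suc (rank (map (λ r → if head r then Vec.zipWith _xor_ p (tail r) else tail r) rest))

at : List Bool → ℕ → Bool
at []      _       = false
at (b ∷ l) zero    = b
at (b ∷ l) (suc i) = at l i

-- the s×k persymmetric matrix (a_{i+j})_{0≤i<s,0≤j<k} given by c = (c_0,…,c_{s+k-2}), as list of rows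
persym : (s k : ℕ) → Vec Bool (s + k ∸ 1) → List (Vec Bool k)
persym s k c = List.map (λ i → tabulate (λ (j : Fin k) → at (toList c) (i + toℕ j))) (List.upTo s)

Γ : (s k i : ℕ) → ℕ
Γ s k i = count (λ abc → rank (persym s k (Data.Product.proj₁ abc)
                              ++ persym s k (Data.Product.proj₁ (Data.Product.proj₂ abc))
                              ++ persym s k (Data.Product.proj₂ (Data.Product.proj₂ abc))) ≡ᵇ i)
  (concatMap (λ a → concatMap (λ b → map (λ c → a , b , c) (allVecs (s + k ∸ 1)))
     (allVecs (s + k ∸ 1))) (allVecs (s + k ∸ 1)))

-- P ↦ E(tP) is a character of F₂[T], and averaging it over the first N digits of
-- t gives the indicator of P = 0 as soon as deg P < N. Expanding g^q as a sum over q-tuples of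
-- quadruples makes the integrand a product of three characters evaluated at the three left-hand
-- sides of the system, so the integral over cylinders of depth N ≥ k + s - 1 counts solutions.
-- In the other direction, the sum over Z in g is 2^s or 0 according as the first s digits of tY
-- vanish. For t, η, ξ on a cylinder of depth s + k - 1 these conditions say that Y lies in the
-- kernel of the stacked persymmetric matrix [A; B; C] built from their digits, so by Gaussian
-- elimination g = 2^(3s) · 2^(k - rank); grouping the cylinders by rank yields the Γ-sum.

module Submission where

open import Algebra.Bundles using (CommutativeSemiring)
open import Data.Bool using (Bool; true; false)
open import Data.List using (List; []; _∷_; _++_; map; concatMap; foldr)
open import Data.Nat using (ℕ; suc)
open import Data.Vec using (Vec; []; _∷_)
open import Relation.Binary.PropositionalEquality as ≡ using (_≡_)

open import Defs

module FiniteSum {c ℓ} (R : CommutativeSemiring c ℓ) where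

  open CommutativeSemiring R
  open import Algebra.Properties.CommutativeSemigroup +-commutativeSemigroup using (interchange)
  open import Relation.Binary.Reasoning.Setoid setoid

  sum : {A : Set} → (A → Carrier) → List A → Carrier
  sum f = foldr (λ x acc → f x + acc) 0#

  product : {A : Set} {n : ℕ} → (A → Carrier) → Vec A n → Carrier
  product f []       = 1#
  product f (x ∷ xs) = f x * product f xs

  module _ {A : Set} where

    sum-cong : {f h : A → Carrier} → (∀ x → f x ≈ h x) → ∀ xs → sum f xs ≈ sum h xs
    sum-cong e []       = refl
    sum-cong e (x ∷ xs) = +-cong (e x) (sum-cong e xs)

    sum-++ : ∀ (f : A → Carrier) xs ys → sum f (xs ++ ys) ≈ sum f xs + sum f ys
    sum-++ f []       ys = sym (+-identityˡ _)
    sum-++ f (x ∷ xs) ys = trans (+-congˡ (sum-++ f xs ys)) (sym (+-assoc (f x) _ _))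

    sum-0 : ∀ (xs : List A) → sum (λ _ → 0#) xs ≈ 0#
    sum-0 []       = refl
    sum-0 (x ∷ xs) = trans (+-identityˡ _) (sum-0 xs)

    sum-+ : ∀ (f h : A → Carrier) xs → sum (λ x → f x + h x) xs ≈ sum f xs + sum h xs
    sum-+ f h []       = sym (+-identityˡ 0#)
    sum-+ f h (x ∷ xs) = trans (+-congˡ (sum-+ f h xs)) (interchange (f x) (h x) _ _)

    sum-*ˡ : ∀ a (f : A → Carrier) xs → sum (λ x → a * f x) xs ≈ a * sum f xs
    sum-*ˡ a f []       = sym (zeroʳ a)
    sum-*ˡ a f (x ∷ xs) = trans (+-congˡ (sum-*ˡ a f xs)) (sym (distribˡ a (f x) _))

    sum-*ʳ : ∀ a (f : A → Carrier) xs → sum (λ x → f x * a) xs ≈ sum f xs * a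
    sum-*ʳ a f xs = begin
      sum (λ x → f x * a) xs ≈⟨ sum-cong (λ x → *-comm (f x) a) xs ⟩
      sum (λ x → a * f x) xs ≈⟨ sum-*ˡ a f xs ⟩
      a * sum f xs           ≈⟨ *-comm a _ ⟩
      sum f xs * a           ∎

  module _ {A B : Set} where

    sum-map : ∀ (f : B → Carrier) (h : A → B) xs → sum f (map h xs) ≡ sum (λ x → f (h x)) xs
    sum-map f h []       = ≡.refl
    sum-map f h (x ∷ xs) = ≡.cong (f (h x) +_) (sum-map f h xs)

    sum-concatMap : ∀ (f : B → Carrier) (h : A → List B) xs →
                    sum f (concatMap h xs) ≈ sum (λ x → sum f (h x)) xs
    sum-concatMap f h []       = refl
    sum-concatMap f h (x ∷ xs) = trans (sum-++ f (h x) (concatMap h xs)) (+-congˡ (sum-concatMap f h xs))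

    sum-comm : ∀ (f : A → B → Carrier) xs ys →
               sum (λ x → sum (f x) ys) xs ≈ sum (λ y → sum (λ x → f x y) xs) ys
    sum-comm f []       ys = sym (sum-0 ys)
    sum-comm f (x ∷ xs) ys = trans (+-congˡ (sum-comm f xs ys)) (sym (sum-+ (f x) (λ y → sum (λ x → f x y) xs) ys))

    sum-*-sum : ∀ (f : A → Carrier) (h : B → Carrier) xs ys →
                sum (λ x → sum (λ y → f x * h y) ys) xs ≈ sum f xs * sum h ys
    sum-*-sum f h xs ys = begin
      sum (λ x → sum (λ y → f x * h y) ys) xs ≈⟨ sum-cong (λ x → sum-*ˡ (f x) h ys) xs ⟩
      sum (λ x → f x * sum h ys) xs           ≈⟨ sum-*ʳ (sum h ys) f xs ⟩
      sum f xs * sum h ys                     ∎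

  module _ {A B C : Set} where

    sum³-* : ∀ (f : A → Carrier) (g : B → Carrier) (h : C → Carrier) xs ys zs →
             sum (λ x → sum (λ y → sum (λ z → f x * (g y * h z)) zs) ys) xs ≈ sum f xs * (sum g ys * sum h zs)
    sum³-* f g h xs ys zs = begin
      sum (λ x → sum (λ y → sum (λ z → f x * (g y * h z)) zs) ys) xs
        ≈⟨ sum-cong (λ x → sum-cong (λ y → sum-*ˡ (f x) (λ z → g y * h z) zs) ys) xs ⟩
      sum (λ x → sum (λ y → f x * sum (λ z → g y * h z) zs) ys) xs
        ≈⟨ sum-cong (λ x → sum-*ˡ (f x) (λ y → sum (λ z → g y * h z) zs) ys) xs ⟩
      sum (λ x → f x * sum (λ y → sum (λ z → g y * h z) zs) ys) xs
        ≈⟨ sum-cong (λ x → *-congˡ (sum-*-sum g h ys zs)) xs ⟩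
      sum (λ x → f x * (sum g ys * sum h zs)) xs
        ≈⟨ sum-*ʳ (sum g ys * sum h zs) f xs ⟩
      sum f xs * (sum g ys * sum h zs) ∎

    sum³-comm : ∀ {D : Set} (F : A → B → C → D → Carrier) xs ys zs ws →
                sum (λ x → sum (λ y → sum (λ z → sum (F x y z) ws) zs) ys) xs
                ≈ sum (λ w → sum (λ x → sum (λ y → sum (λ z → F x y z w) zs) ys) xs) ws
    sum³-comm F xs ys zs ws = begin
      sum (λ x → sum (λ y → sum (λ z → sum (F x y z) ws) zs) ys) xs
        ≈⟨ sum-cong (λ x → sum-cong (λ y → sum-comm (F x y) zs ws) ys) xs ⟩
      sum (λ x → sum (λ y → sum (λ w → sum (λ z → F x y z w) zs) ws) ys) xs
        ≈⟨ sum-cong (λ x → sum-comm (λ y w → sum (λ z → F x y z w) zs) ys ws) xs ⟩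
      sum (λ x → sum (λ w → sum (λ y → sum (λ z → F x y z w) zs) ys) ws) xs
        ≈⟨ sum-comm (λ x w → sum (λ y → sum (λ z → F x y z w) zs) ys) xs ws ⟩
      sum (λ w → sum (λ x → sum (λ y → sum (λ z → F x y z w) zs) ys) xs) ws ∎

  sum-vecsOf-suc : ∀ {A : Set} (f : A → Carrier) xs q →
                   sum (product f) (vecsOf xs (suc q)) ≈ sum f xs * sum (product f) (vecsOf xs q)
  sum-vecsOf-suc f xs q = begin
    sum (product f) (concatMap (λ w → map (_∷ w) xs) (vecsOf xs q))
      ≈⟨ sum-concatMap (product f) (λ w → map (_∷ w) xs) (vecsOf xs q) ⟩
    sum (λ w → sum (product f) (map (_∷ w) xs)) (vecsOf xs q)
      ≈⟨ sum-cong (λ w → reflexive (sum-map (product f) (_∷ w) xs)) (vecsOf xs q) ⟩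
    sum (λ w → sum (λ x → f x * product f w) xs) (vecsOf xs q)
      ≈⟨ sum-comm (λ w x → f x * product f w) (vecsOf xs q) xs ⟩
    sum (λ x → sum (λ w → f x * product f w) (vecsOf xs q)) xs
      ≈⟨ sum-*-sum f (product f) xs (vecsOf xs q) ⟩
    sum f xs * sum (product f) (vecsOf xs q) ∎

  sum-allVecs-suc : ∀ n (f : Vec Bool (suc n) → Carrier) →
                    sum f (allVecs (suc n)) ≈ sum (λ v → f (false ∷ v) + f (true ∷ v)) (allVecs n)
  sum-allVecs-suc n f = trans (sum-concatMap f (λ v → map (_∷ v) bools) (allVecs n))
                              (sum-cong (λ v → +-congˡ (+-identityʳ _)) (allVecs n))

-- Imported only now: inside FiniteSum, _+_, _*_, refl, sym and trans are the semiring's.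
open import Algebra.Bundles using (CommutativeMonoid; CommutativeRing)
open import Algebra.Solver.Ring.AlmostCommutativeRing using (fromCommutativeRing)
open import Data.Bool using (not; _xor_; _∧_; _≟_; if_then_else_)
import Data.Bool.Properties as BoolP
open import Algebra.Solver.Ring.Simple (fromCommutativeRing BoolP.xor-∧-commutativeRing) _≟_
  using (solve; _:+_; _:*_; _:=_)
open import Data.Fin using (Fin; toℕ) renaming (zero to fzero; suc to fsuc)
open import Data.Integer using (ℤ; +_; -[1+_]) renaming (_+_ to _+ℤ_; _*_ to _*ℤ_; _^_ to _^ℤ_)
import Data.Integer.Properties as ℤP
open import Data.List using (length; applyUpTo; upTo)
import Data.List.Properties as ListP
open import Data.Maybe using (Maybe; just; nothing)
open import Data.Nat using (zero; _+_; _*_; _∸_; _^_; _≤_; _<_; _⊓_; _≡ᵇ_; _≤?_; z≤n; s≤s)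
import Data.Nat.Coprimality as Coprimality
import Data.Nat.Properties as ℕP
open import Data.Product using (_×_; _,_)
open import Data.Rational as ℚ using (ℚ; ½; 1ℚ; mkℚ) renaming (_*_ to _*ℚ_; _+_ to _+ℚ_)
import Data.Rational.Properties as ℚP
open import Data.Vec using (toList; tabulate; head; tail; zipWith)
import Data.Vec.Properties as VecP
open import Relation.Binary.PropositionalEquality using (refl; sym; trans; cong; cong₂; subst; module ≡-Reasoning)
open import Relation.Nullary using (Dec; yes; no)

module ℕΣ = FiniteSum ℕP.+-*-commutativeSemiring
module ℤΣ = FiniteSum ℤP.+-*-commutativeSemiring
module ℚΣ = FiniteSum (CommutativeRing.commutativeSemiring ℚP.+-*-commutativeRing)

open ≡-Reasoning

-- The coefficient of T⁻¹ in tP as a pairing of digit sequences with polynomials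

shift : ℕ → 𝕡 → 𝕡
shift i t j = t (i + j)

-- coeffM1 is computed by a where-bound worker that cannot be named here. The metavariable
-- coeffM1-from is solved by unification against it; abstracting the start index 0 with
-- `with` makes the solution the worker itself, at every index.
private
  mutual
    coeffM1-from : 𝕡 → ℕ → Poly → Bool
    coeffM1-from = _

    coeffM1-worker : ∀ t p → coeffM1 t p ≡ coeffM1-from t 0 p
    coeffM1-worker t p with 0
    ... | m = refl

  coeffM1-from-suc : ∀ t m p → coeffM1-from t (suc m) p ≡ coeffM1-from (shift 1 t) m p
  coeffM1-from-suc t m []      = refl
  coeffM1-from-suc t m (b ∷ p) = cong ((t (suc m) ∧ b) xor_) (coeffM1-from-suc t (suc m) p)

coeffM1-∷ : ∀ t b p → coeffM1 t (b ∷ p) ≡ (t 0 ∧ b) xor coeffM1 (shift 1 t) p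
coeffM1-∷ t b p = trans (coeffM1-worker t (b ∷ p))
  (cong ((t 0 ∧ b) xor_) (trans (coeffM1-from-suc t 0 p) (sym (coeffM1-worker (shift 1 t) p))))

coeffM1-cong : ∀ {t t′ : 𝕡} → (∀ j → t j ≡ t′ j) → ∀ p → coeffM1 t p ≡ coeffM1 t′ p
coeffM1-cong e []      = refl
coeffM1-cong {t} {t′} e (b ∷ p) = begin
  coeffM1 t (b ∷ p)                         ≡⟨ coeffM1-∷ t b p ⟩
  (t 0 ∧ b) xor coeffM1 (shift 1 t) p       ≡⟨ cong₂ (λ x y → (x ∧ b) xor y) (e 0) (coeffM1-cong (λ j → e (suc j)) p) ⟩
  (t′ 0 ∧ b) xor coeffM1 (shift 1 t′) p     ≡⟨ coeffM1-∷ t′ b p ⟨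
  coeffM1 t′ (b ∷ p)                        ∎

coeffM1-falseˡ : ∀ p → coeffM1 (λ _ → false) p ≡ false
coeffM1-falseˡ []      = refl
coeffM1-falseˡ (b ∷ p) = trans (coeffM1-∷ (λ _ → false) b p) (coeffM1-falseˡ p)

coeffM1-⊕ : ∀ t p q → coeffM1 t (p ⊕ q) ≡ coeffM1 t p xor coeffM1 t q
coeffM1-⊕ t []      q       = refl
coeffM1-⊕ t (a ∷ p) []      = sym (BoolP.xor-identityʳ _)
coeffM1-⊕ t (a ∷ p) (b ∷ q) = begin
  coeffM1 t ((a xor b) ∷ (p ⊕ q))
    ≡⟨ coeffM1-∷ t (a xor b) (p ⊕ q) ⟩
  (t 0 ∧ (a xor b)) xor coeffM1 (shift 1 t) (p ⊕ q)
    ≡⟨ cong ((t 0 ∧ (a xor b)) xor_) (coeffM1-⊕ (shift 1 t) p q) ⟩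
  (t 0 ∧ (a xor b)) xor (coeffM1 (shift 1 t) p xor coeffM1 (shift 1 t) q)
    ≡⟨ lemma (t 0) a b _ _ ⟩
  ((t 0 ∧ a) xor coeffM1 (shift 1 t) p) xor ((t 0 ∧ b) xor coeffM1 (shift 1 t) q)
    ≡⟨ cong₂ _xor_ (coeffM1-∷ t a p) (coeffM1-∷ t b q) ⟨
  coeffM1 t (a ∷ p) xor coeffM1 t (b ∷ q) ∎
  where
  lemma : ∀ x a b c d → (x ∧ (a xor b)) xor (c xor d) ≡ ((x ∧ a) xor c) xor ((x ∧ b) xor d)
  lemma = solve 5 (λ x a b c d → (x :* (a :+ b)) :+ (c :+ d) := ((x :* a) :+ c) :+ ((x :* b) :+ d)) refl

coeffM1-map-∧ : ∀ t a q → coeffM1 t (map (a ∧_) q) ≡ a ∧ coeffM1 t q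
coeffM1-map-∧ t a []      = sym (BoolP.∧-zeroʳ a)
coeffM1-map-∧ t a (b ∷ q) = begin
  coeffM1 t ((a ∧ b) ∷ map (a ∧_) q)                 ≡⟨ coeffM1-∷ t (a ∧ b) (map (a ∧_) q) ⟩
  (t 0 ∧ (a ∧ b)) xor coeffM1 (shift 1 t) (map (a ∧_) q) ≡⟨ cong ((t 0 ∧ (a ∧ b)) xor_) (coeffM1-map-∧ (shift 1 t) a q) ⟩
  (t 0 ∧ (a ∧ b)) xor (a ∧ coeffM1 (shift 1 t) q)    ≡⟨ lemma (t 0) a b _ ⟩
  a ∧ ((t 0 ∧ b) xor coeffM1 (shift 1 t) q)          ≡⟨ cong (a ∧_) (coeffM1-∷ t b q) ⟨
  a ∧ coeffM1 t (b ∷ q)                              ∎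
  where
  lemma : ∀ x a b d → (x ∧ (a ∧ b)) xor (a ∧ d) ≡ a ∧ ((x ∧ b) xor d)
  lemma = solve 4 (λ x a b d → (x :* (a :* b)) :+ (a :* d) := a :* ((x :* b) :+ d)) refl

coeffM1-xorˡ : ∀ (f h : 𝕡) q → coeffM1 (λ i → f i xor h i) q ≡ coeffM1 f q xor coeffM1 h q
coeffM1-xorˡ f h []      = refl
coeffM1-xorˡ f h (b ∷ q) = begin
  coeffM1 (λ i → f i xor h i) (b ∷ q)
    ≡⟨ coeffM1-∷ (λ i → f i xor h i) b q ⟩
  ((f 0 xor h 0) ∧ b) xor coeffM1 (λ i → f (suc i) xor h (suc i)) q
    ≡⟨ cong (((f 0 xor h 0) ∧ b) xor_) (coeffM1-xorˡ (shift 1 f) (shift 1 h) q) ⟩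
  ((f 0 xor h 0) ∧ b) xor (coeffM1 (shift 1 f) q xor coeffM1 (shift 1 h) q)
    ≡⟨ lemma (f 0) (h 0) b _ _ ⟩
  ((f 0 ∧ b) xor coeffM1 (shift 1 f) q) xor ((h 0 ∧ b) xor coeffM1 (shift 1 h) q)
    ≡⟨ cong₂ _xor_ (coeffM1-∷ f b q) (coeffM1-∷ h b q) ⟨
  coeffM1 f (b ∷ q) xor coeffM1 h (b ∷ q) ∎
  where
  lemma : ∀ x y b c d → ((x xor y) ∧ b) xor (c xor d) ≡ ((x ∧ b) xor c) xor ((y ∧ b) xor d)
  lemma = solve 5 (λ x y b c d → ((x :+ y) :* b) :+ (c :+ d) := ((x :* b) :+ c) :+ ((y :* b) :+ d)) refl

coeffM1-∧ˡ : ∀ (f : 𝕡) a q → coeffM1 (λ i → f i ∧ a) q ≡ coeffM1 f q ∧ a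
coeffM1-∧ˡ f a []      = refl
coeffM1-∧ˡ f a (b ∷ q) = begin
  coeffM1 (λ i → f i ∧ a) (b ∷ q)                          ≡⟨ coeffM1-∷ (λ i → f i ∧ a) b q ⟩
  ((f 0 ∧ a) ∧ b) xor coeffM1 (λ i → f (suc i) ∧ a) q       ≡⟨ cong (((f 0 ∧ a) ∧ b) xor_) (coeffM1-∧ˡ (shift 1 f) a q) ⟩
  ((f 0 ∧ a) ∧ b) xor (coeffM1 (shift 1 f) q ∧ a)           ≡⟨ lemma (f 0) a b _ ⟩
  ((f 0 ∧ b) xor coeffM1 (shift 1 f) q) ∧ a                 ≡⟨ cong (_∧ a) (coeffM1-∷ f b q) ⟨
  coeffM1 f (b ∷ q) ∧ a                                     ∎
  where
  lemma : ∀ x a b d → ((x ∧ a) ∧ b) xor (d ∧ a) ≡ ((x ∧ b) xor d) ∧ a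
  lemma = solve 4 (λ x a b d → ((x :* a) :* b) :+ (d :* a) := ((x :* b) :+ d) :* a) refl

-- In coordinates: the T⁻¹-coefficient of tPQ is Σ_{i,j} t_{i+j} p_j q_i, a Hankel form in (P, Q).
coeffM1-⊗ : ∀ t p q → coeffM1 t (p ⊗ q) ≡ coeffM1 (λ i → coeffM1 (shift i t) p) q
coeffM1-⊗ t []      q = sym (coeffM1-falseˡ q)
coeffM1-⊗ t (a ∷ p) q = begin
  coeffM1 t (map (a ∧_) q ⊕ (false ∷ (p ⊗ q)))
    ≡⟨ coeffM1-⊕ t (map (a ∧_) q) (false ∷ (p ⊗ q)) ⟩
  coeffM1 t (map (a ∧_) q) xor coeffM1 t (false ∷ (p ⊗ q))
    ≡⟨ cong₂ _xor_ (coeffM1-map-∧ t a q) (coeffM1-∷ t false (p ⊗ q)) ⟩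
  (a ∧ coeffM1 t q) xor ((t 0 ∧ false) xor coeffM1 (shift 1 t) (p ⊗ q))
    ≡⟨ cong₂ _xor_ (BoolP.∧-comm a _) (cong (_xor coeffM1 (shift 1 t) (p ⊗ q)) (BoolP.∧-zeroʳ (t 0))) ⟩
  (coeffM1 t q ∧ a) xor coeffM1 (shift 1 t) (p ⊗ q)
    ≡⟨ cong₂ _xor_ (cong (_∧ a) (coeffM1-cong (λ i → cong t (sym (ℕP.+-identityʳ i))) q))
                   (trans (coeffM1-⊗ (shift 1 t) p q)
                          (coeffM1-cong (λ i → coeffM1-cong (λ j → cong t (sym (ℕP.+-suc i j))) p) q)) ⟩
  (coeffM1 (λ i → t (i + 0)) q ∧ a) xor coeffM1 (λ i → coeffM1 (λ j → t (i + suc j)) p) q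
    ≡⟨ cong (_xor _) (coeffM1-∧ˡ (λ i → t (i + 0)) a q) ⟨
  coeffM1 (λ i → t (i + 0) ∧ a) q xor coeffM1 (λ i → coeffM1 (λ j → t (i + suc j)) p) q
    ≡⟨ coeffM1-xorˡ (λ i → t (i + 0) ∧ a) (λ i → coeffM1 (λ j → t (i + suc j)) p) q ⟨
  coeffM1 (λ i → (t (i + 0) ∧ a) xor coeffM1 (λ j → t (i + suc j)) p) q
    ≡⟨ coeffM1-cong (λ i → coeffM1-∷ (shift i t) a p) q ⟨
  coeffM1 (λ i → coeffM1 (shift i t) (a ∷ p)) q ∎

-- Orthogonality of characters

sign : Bool → ℤ
sign b = if b then -[1+ 0 ] else + 1

infix 7.5 [_]×_
[_]×_ : Bool → ℕ → ℤ
[ b ]× m = if b then + m else + 0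

sign-xor : ∀ a b → sign (a xor b) ≡ sign a *ℤ sign b
sign-xor false b     = sym (ℤP.*-identityˡ (sign b))
sign-xor true  false = refl
sign-xor true  true  = refl

E-⊕ : ∀ t p q → E t (p ⊕ q) ≡ E t p *ℤ E t q
E-⊕ t p q = trans (cong sign (coeffM1-⊕ t p q)) (sign-xor (coeffM1 t p) (coeffM1 t q))

[]×-* : ∀ a b m n → [ a ]× m *ℤ [ b ]× n ≡ [ a ∧ b ]× (m * n)
[]×-* true  true  m n = sym (ℤP.pos-* m n)
[]×-* true  false m n = ℤP.*-zeroʳ (+ m)
[]×-* false b     m n = ℤP.*-zeroˡ ([ b ]× n)

[]×-*³ : ∀ a b c m → [ a ]× m *ℤ ([ b ]× m *ℤ [ c ]× m) ≡ [ a ∧ (b ∧ c) ]× (m * (m * m))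
[]×-*³ a b c m = trans (cong ([ a ]× m *ℤ_) ([]×-* b c m m)) ([]×-* a (b ∧ c) m (m * m))

sum-[]× : ∀ {A : Set} (f : A → Bool) m xs → sumℤ (λ x → [ f x ]× m) xs ≡ + (m * count f xs)
sum-[]× f m []       = cong +_ (sym (ℕP.*-zeroʳ m))
sum-[]× f m (x ∷ xs) with f x
... | true  = trans (cong (+ m +ℤ_) (sum-[]× f m xs))
                    (trans (sym (ℤP.pos-+ m _)) (cong +_ (sym (ℕP.*-suc m (count f xs)))))
... | false = trans (ℤP.+-identityˡ _) (sum-[]× f m xs)

sign-+-sign-xor : ∀ b c → sign c +ℤ sign (b xor c) ≡ [ not b ]× 2 *ℤ sign c
sign-+-sign-xor false false = refl
sign-+-sign-xor false true  = refl
sign-+-sign-xor true  false = refl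
sign-+-sign-xor true  true  = refl

prefixZero : ℕ → 𝕡 → Bool
prefixZero zero    t = true
prefixZero (suc n) t = not (t 0) ∧ prefixZero n (shift 1 t)

sum-E-poly : ∀ n t → sumℤ (λ Z → E t (poly Z)) (allVecs n) ≡ [ prefixZero n t ]× 2 ^ n
sum-E-poly zero    t = refl
sum-E-poly (suc n) t = begin
  sumℤ (λ Z → E t (poly Z)) (allVecs (suc n))
    ≡⟨ ℤΣ.sum-allVecs-suc n (λ Z → E t (poly Z)) ⟩
  sumℤ (λ v → E t (false ∷ poly v) +ℤ E t (true ∷ poly v)) (allVecs n)
    ≡⟨ ℤΣ.sum-cong digit (allVecs n) ⟩
  sumℤ (λ v → [ not (t 0) ]× 2 *ℤ E (shift 1 t) (poly v)) (allVecs n)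
    ≡⟨ ℤΣ.sum-*ˡ ([ not (t 0) ]× 2) (λ v → E (shift 1 t) (poly v)) (allVecs n) ⟩
  [ not (t 0) ]× 2 *ℤ sumℤ (λ v → E (shift 1 t) (poly v)) (allVecs n)
    ≡⟨ cong ([ not (t 0) ]× 2 *ℤ_) (sum-E-poly n (shift 1 t)) ⟩
  [ not (t 0) ]× 2 *ℤ [ prefixZero n (shift 1 t) ]× 2 ^ n
    ≡⟨ []×-* (not (t 0)) _ 2 (2 ^ n) ⟩
  [ prefixZero (suc n) t ]× 2 ^ suc n ∎
  where
  digit : ∀ v → E t (false ∷ poly v) +ℤ E t (true ∷ poly v) ≡ [ not (t 0) ]× 2 *ℤ E (shift 1 t) (poly v)
  digit v = begin
    E t (false ∷ poly v) +ℤ E t (true ∷ poly v)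
      ≡⟨ cong₂ (λ x y → sign x +ℤ sign y) (coeffM1-∷ t false (poly v)) (coeffM1-∷ t true (poly v)) ⟩
    sign ((t 0 ∧ false) xor c) +ℤ sign ((t 0 ∧ true) xor c)
      ≡⟨ cong₂ (λ x y → sign (x xor c) +ℤ sign (y xor c)) (BoolP.∧-zeroʳ (t 0)) (BoolP.∧-identityʳ (t 0)) ⟩
    sign c +ℤ sign (t 0 xor c)
      ≡⟨ sign-+-sign-xor (t 0) c ⟩
    [ not (t 0) ]× 2 *ℤ sign c ∎
    where c = coeffM1 (shift 1 t) (poly v)

sum-E-extend : ∀ N P → length P ≤ N → sumℤ (λ a → E (extend a) P) (allVecs N) ≡ [ isZero P ]× 2 ^ N
sum-E-extend zero    []      _         = refl
sum-E-extend zero    (_ ∷ _) ()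
sum-E-extend (suc N) P       |P|≤1+N   = begin
  sumℤ (λ a → E (extend a) P) (allVecs (suc N))
    ≡⟨ ℤΣ.sum-allVecs-suc N (λ a → E (extend a) P) ⟩
  sumℤ (λ v → E (extend (false ∷ v)) P +ℤ E (extend (true ∷ v)) P) (allVecs N)
    ≡⟨ ℤΣ.sum-cong (digit P) (allVecs N) ⟩
  sumℤ (λ v → [ not (constTerm P) ]× 2 *ℤ E (extend v) (divT P)) (allVecs N)
    ≡⟨ ℤΣ.sum-*ˡ ([ not (constTerm P) ]× 2) (λ v → E (extend v) (divT P)) (allVecs N) ⟩
  [ not (constTerm P) ]× 2 *ℤ sumℤ (λ v → E (extend v) (divT P)) (allVecs N)
    ≡⟨ cong ([ not (constTerm P) ]× 2 *ℤ_) (sum-E-extend N (divT P) (length-divT P |P|≤1+N)) ⟩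
  [ not (constTerm P) ]× 2 *ℤ [ isZero (divT P) ]× 2 ^ N
    ≡⟨ []×-* (not (constTerm P)) _ 2 (2 ^ N) ⟩
  [ not (constTerm P) ∧ isZero (divT P) ]× 2 ^ suc N
    ≡⟨ cong ([_]× 2 ^ suc N) (isZero-constTerm-divT P) ⟩
  [ isZero P ]× 2 ^ suc N ∎
  where
  constTerm : Poly → Bool
  constTerm []      = false
  constTerm (b ∷ _) = b
  divT : Poly → Poly
  divT []      = []
  divT (_ ∷ P) = P
  length-divT : ∀ P → length P ≤ suc N → length (divT P) ≤ N
  length-divT []      _         = z≤n
  length-divT (_ ∷ P) (s≤s |P|≤N) = |P|≤N
  isZero-constTerm-divT : ∀ P → not (constTerm P) ∧ isZero (divT P) ≡ isZero P
  isZero-constTerm-divT []          = refl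
  isZero-constTerm-divT (false ∷ P) = refl
  isZero-constTerm-divT (true  ∷ P) = refl
  digit : ∀ P v → E (extend (false ∷ v)) P +ℤ E (extend (true ∷ v)) P ≡ [ not (constTerm P) ]× 2 *ℤ E (extend v) (divT P)
  digit []      v = refl
  digit (b ∷ P) v = begin
    E (extend (false ∷ v)) (b ∷ P) +ℤ E (extend (true ∷ v)) (b ∷ P)
      ≡⟨ cong₂ (λ x y → sign x +ℤ sign y) (coeffM1-∷ (extend (false ∷ v)) b P) (coeffM1-∷ (extend (true ∷ v)) b P) ⟩
    sign (coeffM1 (extend v) P) +ℤ sign (b xor coeffM1 (extend v) P)
      ≡⟨ sign-+-sign-xor b _ ⟩
    [ not b ]× 2 *ℤ E (extend v) P ∎

-- Expanding g^q

Triple : Set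
Triple = Poly × Poly × Poly

_⊕³_ : Triple → Triple → Triple
(a , b , c) ⊕³ (a′ , b′ , c′) = a ⊕ a′ , b ⊕ b′ , c ⊕ c′

products : ∀ {k s} → Quad k s → Triple
products (y , z , u , v) = poly y ⊗ poly z , poly y ⊗ poly u , poly y ⊗ poly v

sums-∷ : ∀ {k s q} (x : Quad k s) (w : Vec (Quad k s) q) → sums (x ∷ w) ≡ products x ⊕³ sums w
sums-∷ (y , z , u , v) w with sums w
... | a , b , c = refl

isZero³ : Triple → Bool
isZero³ (a , b , c) = isZero a ∧ (isZero b ∧ isZero c)

isSolution-sums : ∀ {k s q} (w : Vec (Quad k s) q) → isSolution w ≡ isZero³ (sums w)
isSolution-sums w with sums w
... | a , b , c = refl

χ : 𝕡 → 𝕡 → 𝕡 → Triple → ℤ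
χ t η ξ (a , b , c) = E t a *ℤ (E η b *ℤ E ξ c)

χ-⊕³ : ∀ t η ξ P Q → χ t η ξ (P ⊕³ Q) ≡ χ t η ξ P *ℤ χ t η ξ Q
χ-⊕³ t η ξ (a , b , c) (a′ , b′ , c′) = begin
  E t (a ⊕ a′) *ℤ (E η (b ⊕ b′) *ℤ E ξ (c ⊕ c′))
    ≡⟨ cong₂ _*ℤ_ (E-⊕ t a a′) (cong₂ _*ℤ_ (E-⊕ η b b′) (E-⊕ ξ c c′)) ⟩
  (E t a *ℤ E t a′) *ℤ ((E η b *ℤ E η b′) *ℤ (E ξ c *ℤ E ξ c′))
    ≡⟨ cong ((E t a *ℤ E t a′) *ℤ_) (interchange (E η b) _ _ _) ⟩
  (E t a *ℤ E t a′) *ℤ ((E η b *ℤ E ξ c) *ℤ (E η b′ *ℤ E ξ c′))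
    ≡⟨ interchange (E t a) _ _ _ ⟩
  χ t η ξ (a , b , c) *ℤ χ t η ξ (a′ , b′ , c′) ∎
  where open import Algebra.Properties.CommutativeSemigroup ℤP.*-commutativeSemigroup using (interchange)

product-χ : ∀ {k s q} t η ξ (w : Vec (Quad k s) q) →
            ℤΣ.product (λ x → χ t η ξ (products x)) w ≡ χ t η ξ (sums w)
product-χ t η ξ []      = refl
product-χ t η ξ (x ∷ w) = begin
  χ t η ξ (products x) *ℤ ℤΣ.product (λ x → χ t η ξ (products x)) w ≡⟨ cong (χ t η ξ (products x) *ℤ_) (product-χ t η ξ w) ⟩
  χ t η ξ (products x) *ℤ χ t η ξ (sums w)                          ≡⟨ χ-⊕³ t η ξ (products x) (sums w) ⟨
  χ t η ξ (products x ⊕³ sums w)                                    ≡⟨ cong (χ t η ξ) (sums-∷ x w) ⟨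
  χ t η ξ (sums (x ∷ w))                                            ∎

g-as-sum-allQuads : ∀ k s t η ξ → g k s t η ξ ≡ sumℤ (λ x → χ t η ξ (products x)) (allQuads k s)
g-as-sum-allQuads k s t η ξ = sym (begin
  sumℤ F (allQuads k s)
    ≡⟨ ℤΣ.sum-concatMap F _ (allVecs k) ⟩
  sumℤ (λ y → sumℤ F (concatMap (λ z → concatMap (λ u → map (λ v → y , z , u , v) Vs) Vs) Vs)) (allVecs k)
    ≡⟨ ℤΣ.sum-cong (λ y → ℤΣ.sum-concatMap F _ Vs) (allVecs k) ⟩
  sumℤ (λ y → sumℤ (λ z → sumℤ F (concatMap (λ u → map (λ v → y , z , u , v) Vs) Vs)) Vs) (allVecs k)
    ≡⟨ ℤΣ.sum-cong (λ y → ℤΣ.sum-cong (λ z → ℤΣ.sum-concatMap F _ Vs) Vs) (allVecs k) ⟩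
  sumℤ (λ y → sumℤ (λ z → sumℤ (λ u → sumℤ F (map (λ v → y , z , u , v) Vs)) Vs) Vs) (allVecs k)
    ≡⟨ ℤΣ.sum-cong (λ y → ℤΣ.sum-cong (λ z → ℤΣ.sum-cong (λ u → ℤΣ.sum-map F (λ v → y , z , u , v) Vs) Vs) Vs) (allVecs k) ⟩
  sumℤ (λ y → sumℤ (λ z → sumℤ (λ u → sumℤ (λ v → e t y z *ℤ (e η y u *ℤ e ξ y v)) Vs) Vs) Vs) (allVecs k)
    ≡⟨ ℤΣ.sum-cong (λ y → ℤΣ.sum³-* (e t y) (e η y) (e ξ y) Vs Vs Vs) (allVecs k) ⟩
  g k s t η ξ ∎)
  where
  Vs = allVecs s
  F = λ (x : Quad k s) → χ t η ξ (products x)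
  e : 𝕡 → Vec Bool k → Vec Bool s → ℤ
  e t y z = E t (poly y ⊗ poly z)

^-sum : ∀ {A : Set} (f : A → ℤ) xs q → sumℤ f xs ^ℤ q ≡ sumℤ (ℤΣ.product f) (vecsOf xs q)
^-sum f xs zero    = refl
^-sum f xs (suc q) = trans (cong (sumℤ f xs *ℤ_) (^-sum f xs q)) (sym (ℤΣ.sum-vecsOf-suc f xs q))

g^q-as-sum : ∀ q k s t η ξ → g k s t η ξ ^ℤ q ≡ sumℤ (λ w → χ t η ξ (sums w)) (vecsOf (allQuads k s) q)
g^q-as-sum q k s t η ξ = begin
  g k s t η ξ ^ℤ q
    ≡⟨ cong (_^ℤ q) (g-as-sum-allQuads k s t η ξ) ⟩
  sumℤ (λ x → χ t η ξ (products x)) (allQuads k s) ^ℤ q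
    ≡⟨ ^-sum _ (allQuads k s) q ⟩
  sumℤ (ℤΣ.product (λ x → χ t η ξ (products x))) (vecsOf (allQuads k s) q)
    ≡⟨ ℤΣ.sum-cong (product-χ t η ξ) (vecsOf (allQuads k s) q) ⟩
  sumℤ (λ w → χ t η ξ (sums w)) (vecsOf (allQuads k s) q) ∎

-- The integral counts solutions

length-⊕-≤ : ∀ {L} p q → length p ≤ L → length q ≤ L → length (p ⊕ q) ≤ L
length-⊕-≤             []      q       _         |q|≤L     = |q|≤L
length-⊕-≤             (a ∷ p) []      |p|≤L     _         = |p|≤L
length-⊕-≤ {L = suc L} (a ∷ p) (b ∷ q) (s≤s |p|≤L) (s≤s |q|≤L) = s≤s (length-⊕-≤ p q |p|≤L |q|≤L)

length-⊗-∷ : ∀ p b q → length (p ⊗ (b ∷ q)) ≤ length p + length q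
length-⊗-∷ []      b q = z≤n
length-⊗-∷ (a ∷ p) b q = length-⊕-≤ (map (a ∧_) (b ∷ q)) (false ∷ (p ⊗ (b ∷ q)))
  (s≤s (ℕP.≤-trans (ℕP.≤-reflexive (ListP.length-map (a ∧_) q)) (ℕP.m≤n+m (length q) (length p))))
  (s≤s (length-⊗-∷ p b q))

length-poly-⊗ : ∀ {k s} (y : Vec Bool k) (z : Vec Bool (suc s)) → length (poly y ⊗ poly z) ≤ k + s
length-poly-⊗ y (b ∷ z) = ℕP.≤-trans (length-⊗-∷ (toList y) b (toList z))
  (ℕP.≤-reflexive (cong₂ _+_ (VecP.length-toList y) (VecP.length-toList z)))

Bounded³ : ℕ → Triple → Set
Bounded³ N (a , b , c) = length a ≤ N × length b ≤ N × length c ≤ N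

sums-bounded : ∀ {k s q N} → k + s ≤ N → (w : Vec (Quad k (suc s)) q) → Bounded³ N (sums w)
sums-bounded k+s≤N []      = z≤n , z≤n , z≤n
sums-bounded {N = N} k+s≤N (x ∷ w) = subst (Bounded³ N) (sym (sums-∷ x w)) (step x (sums w) (sums-bounded k+s≤N w))
  where
  bound : ∀ y z → length (poly y ⊗ poly z) ≤ N
  bound y z = ℕP.≤-trans (length-poly-⊗ y z) k+s≤N
  step : ∀ x T → Bounded³ N T → Bounded³ N (products x ⊕³ T)
  step (y , z , u , v) (a , b , c) (|a| , |b| , |c|) =
    length-⊕-≤ (poly y ⊗ poly z) a (bound y z) |a| ,
    length-⊕-≤ (poly y ⊗ poly u) b (bound y u) |b| ,
    length-⊕-≤ (poly y ⊗ poly v) c (bound y v) |c|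

cylinderSum : ℕ → (𝕡 → 𝕡 → 𝕡 → ℤ) → ℤ
cylinderSum N f = sumℤ (λ a → sumℤ (λ b → sumℤ (λ c → f (extend a) (extend b) (extend c))
  (allVecs N)) (allVecs N)) (allVecs N)

cylinderSum-χ : ∀ N T → Bounded³ N T → cylinderSum N (λ t η ξ → χ t η ξ T) ≡ [ isZero³ T ]× (2 ^ N * (2 ^ N * 2 ^ N))
cylinderSum-χ N (A , B , C) (|A| , |B| , |C|) = begin
  cylinderSum N (λ t η ξ → χ t η ξ (A , B , C))
    ≡⟨ ℤΣ.sum³-* (λ a → E (extend a) A) (λ b → E (extend b) B) (λ c → E (extend c) C) Vs Vs Vs ⟩
  sumℤ (λ a → E (extend a) A) Vs *ℤ (sumℤ (λ b → E (extend b) B) Vs *ℤ sumℤ (λ c → E (extend c) C) Vs)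
    ≡⟨ cong₂ _*ℤ_ (sum-E-extend N A |A|) (cong₂ _*ℤ_ (sum-E-extend N B |B|) (sum-E-extend N C |C|)) ⟩
  [ isZero A ]× 2 ^ N *ℤ ([ isZero B ]× 2 ^ N *ℤ [ isZero C ]× 2 ^ N)
    ≡⟨ []×-*³ (isZero A) (isZero B) (isZero C) (2 ^ N) ⟩
  [ isZero³ (A , B , C) ]× (2 ^ N * (2 ^ N * 2 ^ N)) ∎
  where
  Vs = allVecs N

cylinderSum-g^q : ∀ q k s N → k + s ≤ N →
  cylinderSum N (λ t η ξ → g k (suc s) t η ξ ^ℤ q) ≡ + (2 ^ N * (2 ^ N * 2 ^ N) * R q k (suc s))
cylinderSum-g^q q k s N k+s≤N = begin
  cylinderSum N (λ t η ξ → g k (suc s) t η ξ ^ℤ q)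
    ≡⟨ ℤΣ.sum-cong (λ a → ℤΣ.sum-cong (λ b → ℤΣ.sum-cong (λ c →
         g^q-as-sum q k (suc s) (extend a) (extend b) (extend c)) Vs) Vs) Vs ⟩
  sumℤ (λ a → sumℤ (λ b → sumℤ (λ c → sumℤ (λ w → χ (extend a) (extend b) (extend c) (sums w)) Ws) Vs) Vs) Vs
    ≡⟨ ℤΣ.sum³-comm (λ a b c w → χ (extend a) (extend b) (extend c) (sums w)) Vs Vs Vs Ws ⟩
  sumℤ (λ w → cylinderSum N (λ t η ξ → χ t η ξ (sums w))) Ws
    ≡⟨ ℤΣ.sum-cong (λ w → trans (cylinderSum-χ N (sums w) (sums-bounded k+s≤N w))
                                (cong ([_]× _) (sym (isSolution-sums w)))) Ws ⟩
  sumℤ (λ w → [ isSolution w ]× (2 ^ N * (2 ^ N * 2 ^ N))) Ws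
    ≡⟨ sum-[]× isSolution _ Ws ⟩
  + (2 ^ N * (2 ^ N * 2 ^ N) * R q k (suc s)) ∎
  where
  Vs = allVecs N
  Ws = vecsOf (allQuads k (suc s)) q

ℕtoℚ-mkℚ : ∀ n → ℕtoℚ n ≡ mkℚ (+ n) 0 (Coprimality.sym (Coprimality.1-coprimeTo n))
ℕtoℚ-mkℚ n = ℚP.normalize-coprime (Coprimality.sym (Coprimality.1-coprimeTo n))

ℕtoℚ-* : ∀ m n → ℕtoℚ (m * n) ≡ ℕtoℚ m *ℚ ℕtoℚ n
ℕtoℚ-* m n = sym (trans (cong₂ _*ℚ_ (ℕtoℚ-mkℚ m) (ℕtoℚ-mkℚ n)) (cong (ℚ._/ 1) (sym (ℤP.pos-* m n))))

ℕtoℚ-+ : ∀ m n → ℕtoℚ (m + n) ≡ ℕtoℚ m +ℚ ℕtoℚ n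
ℕtoℚ-+ m n = sym (trans (cong₂ _+ℚ_ (ℕtoℚ-mkℚ m) (ℕtoℚ-mkℚ n))
  (cong (ℚ._/ 1) (trans (cong₂ _+ℤ_ (ℤP.*-identityʳ (+ m)) (ℤP.*-identityʳ (+ n))) (sym (ℤP.pos-+ m n)))))

½^n*2^n≡1 : ∀ n → powℚ ½ n *ℚ ℕtoℚ (2 ^ n) ≡ 1ℚ
½^n*2^n≡1 zero    = refl
½^n*2^n≡1 (suc n) = begin
  (½ *ℚ powℚ ½ n) *ℚ ℕtoℚ (2 * 2 ^ n)           ≡⟨ cong ((½ *ℚ powℚ ½ n) *ℚ_) (ℕtoℚ-* 2 (2 ^ n)) ⟩
  (½ *ℚ powℚ ½ n) *ℚ (ℕtoℚ 2 *ℚ ℕtoℚ (2 ^ n))   ≡⟨ interchange ½ (powℚ ½ n) (ℕtoℚ 2) (ℕtoℚ (2 ^ n)) ⟩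
  (½ *ℚ ℕtoℚ 2) *ℚ (powℚ ½ n *ℚ ℕtoℚ (2 ^ n))   ≡⟨ cong (1ℚ *ℚ_) (½^n*2^n≡1 n) ⟩
  1ℚ                                             ∎
  where
  open import Algebra.Properties.CommutativeSemigroup (CommutativeMonoid.commutativeSemigroup ℚP.*-1-commutativeMonoid) using (interchange)

½^n*2^n*m≡m : ∀ n m → powℚ ½ n *ℚ ℕtoℚ (2 ^ n * m) ≡ ℕtoℚ m
½^n*2^n*m≡m n m = begin
  powℚ ½ n *ℚ ℕtoℚ (2 ^ n * m)            ≡⟨ cong (powℚ ½ n *ℚ_) (ℕtoℚ-* (2 ^ n) m) ⟩
  powℚ ½ n *ℚ (ℕtoℚ (2 ^ n) *ℚ ℕtoℚ m)    ≡⟨ ℚP.*-assoc (powℚ ½ n) _ _ ⟨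
  (powℚ ½ n *ℚ ℕtoℚ (2 ^ n)) *ℚ ℕtoℚ m    ≡⟨ cong (_*ℚ ℕtoℚ m) (½^n*2^n≡1 n) ⟩
  1ℚ *ℚ ℕtoℚ m                            ≡⟨ ℚP.*-identityˡ _ ⟩
  ℕtoℚ m                                  ∎

2^n³ : ∀ n → 2 ^ n * (2 ^ n * 2 ^ n) ≡ 2 ^ (3 * n)
2^n³ n = begin
  2 ^ n * (2 ^ n * 2 ^ n)   ≡⟨ cong (2 ^ n *_) (ℕP.^-distribˡ-+-* 2 n n) ⟨
  2 ^ n * 2 ^ (n + n)       ≡⟨ ℕP.^-distribˡ-+-* 2 n (n + n) ⟨
  2 ^ (n + (n + n))         ≡⟨ cong (λ m → 2 ^ (n + (n + m))) (ℕP.+-identityʳ n) ⟨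
  2 ^ (3 * n)               ∎

R≡integral : ∀ q k s N → k + s ≤ N → ℕtoℚ (R q k (suc s)) ≡ integral3 N (λ t η ξ → g k (suc s) t η ξ ^ℤ q)
R≡integral q k s N k+s≤N = sym (begin
  powℚ ½ (3 * N) *ℚ (cylinderSum N (λ t η ξ → g k (suc s) t η ξ ^ℤ q) ℚ./ 1)
    ≡⟨ cong (λ z → powℚ ½ (3 * N) *ℚ (z ℚ./ 1)) (cylinderSum-g^q q k s N k+s≤N) ⟩
  powℚ ½ (3 * N) *ℚ ℕtoℚ (2 ^ N * (2 ^ N * 2 ^ N) * R q k (suc s))
    ≡⟨ cong (λ m → powℚ ½ (3 * N) *ℚ ℕtoℚ (m * R q k (suc s))) (2^n³ N) ⟩
  powℚ ½ (3 * N) *ℚ ℕtoℚ (2 ^ (3 * N) * R q k (suc s))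
    ≡⟨ ½^n*2^n*m≡m (3 * N) (R q k (suc s)) ⟩
  ℕtoℚ (R q k (suc s)) ∎)

-- Kernels over F₂ and Gaussian elimination

𝟙 : Bool → ℕ
𝟙 b = if b then 1 else 0

count≡sum-𝟙 : ∀ {A : Set} (f : A → Bool) xs → count f xs ≡ ℕΣ.sum (λ x → 𝟙 (f x)) xs
count≡sum-𝟙 f []       = refl
count≡sum-𝟙 f (x ∷ xs) with f x
... | true  = cong suc (count≡sum-𝟙 f xs)
... | false = count≡sum-𝟙 f xs

count-cong : ∀ {A : Set} {f h : A → Bool} → (∀ x → f x ≡ h x) → ∀ xs → count f xs ≡ count h xs
count-cong {f = f} {h} f≗h xs = begin
  count f xs                  ≡⟨ count≡sum-𝟙 f xs ⟩
  ℕΣ.sum (λ x → 𝟙 (f x)) xs   ≡⟨ ℕΣ.sum-cong (λ x → cong 𝟙 (f≗h x)) xs ⟩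
  ℕΣ.sum (λ x → 𝟙 (h x)) xs   ≡⟨ count≡sum-𝟙 h xs ⟨
  count h xs                  ∎

count-allVecs-suc : ∀ n (f : Vec Bool (suc n) → Bool) →
  count f (allVecs (suc n)) ≡ ℕΣ.sum (λ v → 𝟙 (f (false ∷ v)) + 𝟙 (f (true ∷ v))) (allVecs n)
count-allVecs-suc n f = trans (count≡sum-𝟙 f (allVecs (suc n))) (ℕΣ.sum-allVecs-suc n (λ v → 𝟙 (f v)))

dot : ∀ {n} → Vec Bool n → Vec Bool n → Bool
dot []      []      = false
dot (a ∷ r) (b ∷ y) = (a ∧ b) xor dot r y

dot-zipWith-xor : ∀ {n} (p r v : Vec Bool n) → dot (zipWith _xor_ p r) v ≡ dot p v xor dot r v
dot-zipWith-xor []      []      []      = refl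
dot-zipWith-xor (a ∷ p) (b ∷ r) (c ∷ v) =
  trans (cong (((a xor b) ∧ c) xor_) (dot-zipWith-xor p r v)) (lemma a b c (dot p v) (dot r v))
  where
  lemma : ∀ a b c x y → ((a xor b) ∧ c) xor (x xor y) ≡ ((a ∧ c) xor x) xor ((b ∧ c) xor y)
  lemma = solve 5 (λ a b c x y → ((a :+ b) :* c) :+ (x :+ y) := ((a :* c) :+ x) :+ ((b :* c) :+ y)) refl

inKernel : ∀ {n} → List (Vec Bool n) → Vec Bool n → Bool
inKernel []       Y = true
inKernel (r ∷ rs) Y = not (dot r Y) ∧ inKernel rs Y

inKernel-++ : ∀ {n} (xs ys : List (Vec Bool n)) Y → inKernel (xs ++ ys) Y ≡ inKernel xs Y ∧ inKernel ys Y
inKernel-++ []       ys Y = refl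
inKernel-++ (x ∷ xs) ys Y = trans (cong (not (dot x Y) ∧_) (inKernel-++ xs ys Y)) (sym (BoolP.∧-assoc (not (dot x Y)) _ _))

inKernel-width-0 : ∀ (rows : List (Vec Bool 0)) → inKernel rows [] ≡ true
inKernel-width-0 []        = refl
inKernel-width-0 ([] ∷ rs) = inKernel-width-0 rs

eliminate : ∀ {n} → Vec Bool n → Vec Bool (suc n) → Vec Bool n
eliminate p r = if head r then zipWith _xor_ p (tail r) else tail r

-- Solving the pivot equation for the first coordinate substitutes it into the remaining rows.
inKernel-eliminate : ∀ {n} (rows : List (Vec Bool (suc n))) p v →
  inKernel rows (dot p v ∷ v) ≡ inKernel (map (eliminate p) rows) v
inKernel-eliminate []                 p v = refl
inKernel-eliminate ((true  ∷ r) ∷ rs) p v =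
  cong₂ (λ a b → not a ∧ b) (sym (dot-zipWith-xor p r v)) (inKernel-eliminate rs p v)
inKernel-eliminate ((false ∷ r) ∷ rs) p v = cong (not (dot r v) ∧_) (inKernel-eliminate rs p v)

PickSpec : ∀ {n} → List (Vec Bool (suc n)) → Maybe (Vec Bool n × List (Vec Bool (suc n))) → Set
PickSpec rows nothing           = ∀ x v → inKernel rows (x ∷ v) ≡ inKernel (map tail rows) v
PickSpec rows (just (p , rest)) = (∀ x v → inKernel rows (x ∷ v) ≡ not (x xor dot p v) ∧ inKernel rest (x ∷ v))
                                × suc (length rest) ≡ length rows

pick-spec : ∀ {n} (rows : List (Vec Bool (suc n))) → PickSpec rows (pick rows)
pick-spec []                 = λ x v → refl
pick-spec ((true  ∷ r) ∷ rs) = (λ x v → refl) , refl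
pick-spec ((false ∷ r) ∷ rs) with pick rs | pick-spec rs
... | nothing         | spec          = λ x v → cong (not (dot r v) ∧_) (spec x v)
... | just (p , rest) | spec , length = (λ x v → trans (cong (not (dot r v) ∧_) (spec x v))
                                                      (∧-left-comm (not (dot r v)) (not (x xor dot p v)) (inKernel rest (x ∷ v))))
                                      , cong suc length
  where
  ∧-left-comm : ∀ a b c → a ∧ (b ∧ c) ≡ b ∧ (a ∧ c)
  ∧-left-comm = solve 3 (λ a b c → a :* (b :* c) := b :* (a :* c)) refl

rank≤width : ∀ n (rows : List (Vec Bool n)) → rank rows ≤ n
rank≤width zero    rows = z≤n
rank≤width (suc n) rows with pick rows
... | nothing         = ℕP.m≤n⇒m≤1+n (rank≤width n (map tail rows))
... | just (p , rest) = s≤s (rank≤width n (map (eliminate p) rest))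

rank≤length : ∀ n (rows : List (Vec Bool n)) → rank rows ≤ length rows
rank≤length zero    rows = z≤n
rank≤length (suc n) rows with pick rows | pick-spec rows
... | nothing         | _ = ℕP.≤-trans (rank≤length n (map tail rows)) (ℕP.≤-reflexive (ListP.length-map tail rows))
... | just (p , rest) | _ , |rest|<|rows| = ℕP.≤-trans
  (s≤s (ℕP.≤-trans (rank≤length n (map (eliminate p) rest)) (ℕP.≤-reflexive (ListP.length-map (eliminate p) rest))))
  (ℕP.≤-reflexive |rest|<|rows|)

module _ {n} (rows : List (Vec Bool (suc n))) where

  count-kernel-without-pivot : ∀ rows′ → (∀ x v → inKernel rows (x ∷ v) ≡ inKernel rows′ v) →
    count (inKernel rows) (allVecs (suc n)) ≡ 2 * count (inKernel rows′) (allVecs n)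
  count-kernel-without-pivot rows′ spec = begin
    count (inKernel rows) (allVecs (suc n))
      ≡⟨ count-allVecs-suc n (inKernel rows) ⟩
    ℕΣ.sum (λ v → 𝟙 (inKernel rows (false ∷ v)) + 𝟙 (inKernel rows (true ∷ v))) (allVecs n)
      ≡⟨ ℕΣ.sum-cong (λ v → trans (cong₂ (λ a b → 𝟙 a + 𝟙 b) (spec false v) (spec true v))
                                  (cong (λ m → 𝟙 (inKernel rows′ v) + m) (sym (ℕP.+-identityʳ _)))) (allVecs n) ⟩
    ℕΣ.sum (λ v → 2 * 𝟙 (inKernel rows′ v)) (allVecs n)
      ≡⟨ ℕΣ.sum-*ˡ 2 (λ v → 𝟙 (inKernel rows′ v)) (allVecs n) ⟩
    2 * ℕΣ.sum (λ v → 𝟙 (inKernel rows′ v)) (allVecs n)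
      ≡⟨ cong (2 *_) (count≡sum-𝟙 (inKernel rows′) (allVecs n)) ⟨
    2 * count (inKernel rows′) (allVecs n) ∎

  count-kernel-with-pivot : ∀ p rest → (∀ x v → inKernel rows (x ∷ v) ≡ not (x xor dot p v) ∧ inKernel rest (x ∷ v)) →
    count (inKernel rows) (allVecs (suc n)) ≡ count (inKernel (map (eliminate p) rest)) (allVecs n)
  count-kernel-with-pivot p rest spec = begin
    count (inKernel rows) (allVecs (suc n))
      ≡⟨ count-allVecs-suc n (inKernel rows) ⟩
    ℕΣ.sum (λ v → 𝟙 (inKernel rows (false ∷ v)) + 𝟙 (inKernel rows (true ∷ v))) (allVecs n)
      ≡⟨ ℕΣ.sum-cong (λ v → trans (cong₂ (λ a b → 𝟙 a + 𝟙 b) (spec false v) (spec true v))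
                                  (only-pivot-value (dot p v) (λ x → inKernel rest (x ∷ v)))) (allVecs n) ⟩
    ℕΣ.sum (λ v → 𝟙 (inKernel rest (dot p v ∷ v))) (allVecs n)
      ≡⟨ ℕΣ.sum-cong (λ v → cong 𝟙 (inKernel-eliminate rest p v)) (allVecs n) ⟩
    ℕΣ.sum (λ v → 𝟙 (inKernel (map (eliminate p) rest) v)) (allVecs n)
      ≡⟨ count≡sum-𝟙 (inKernel (map (eliminate p) rest)) (allVecs n) ⟨
    count (inKernel (map (eliminate p) rest)) (allVecs n) ∎
    where
    only-pivot-value : ∀ d (A : Bool → Bool) → 𝟙 (not (false xor d) ∧ A false) + 𝟙 (not (true xor d) ∧ A true) ≡ 𝟙 (A d)
    only-pivot-value false A = ℕP.+-identityʳ (𝟙 (A false))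
    only-pivot-value true  A = refl

kernel-size : ∀ n (rows : List (Vec Bool n)) → count (inKernel rows) (allVecs n) * 2 ^ rank rows ≡ 2 ^ n
kernel-size zero    rows = cong (λ b → 𝟙 b * 1) (inKernel-width-0 rows)
kernel-size (suc n) rows with pick rows | pick-spec rows
... | nothing         | spec = begin
  count (inKernel rows) (allVecs (suc n)) * 2 ^ rank (map tail rows)
    ≡⟨ cong (_* 2 ^ rank (map tail rows)) (count-kernel-without-pivot rows (map tail rows) spec) ⟩
  2 * count (inKernel (map tail rows)) (allVecs n) * 2 ^ rank (map tail rows)
    ≡⟨ ℕP.*-assoc 2 (count (inKernel (map tail rows)) (allVecs n)) (2 ^ rank (map tail rows)) ⟩
  2 * (count (inKernel (map tail rows)) (allVecs n) * 2 ^ rank (map tail rows))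
    ≡⟨ cong (2 *_) (kernel-size n (map tail rows)) ⟩
  2 ^ suc n ∎
... | just (p , rest) | spec , _ = begin
  count (inKernel rows) (allVecs (suc n)) * (2 * 2 ^ rank rows′)
    ≡⟨ cong (_* (2 * 2 ^ rank rows′)) (count-kernel-with-pivot rows p rest spec) ⟩
  count (inKernel rows′) (allVecs n) * (2 * 2 ^ rank rows′)
    ≡⟨ x∙yz≈y∙xz (count (inKernel rows′) (allVecs n)) 2 (2 ^ rank rows′) ⟩
  2 * (count (inKernel rows′) (allVecs n) * 2 ^ rank rows′)
    ≡⟨ cong (2 *_) (kernel-size n rows′) ⟩
  2 ^ suc n ∎
  where
  open import Algebra.Properties.CommutativeSemigroup ℕP.*-commutativeSemigroup using (x∙yz≈y∙xz)
  rows′ = map (eliminate p) rest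

count-kernel : ∀ n (rows : List (Vec Bool n)) → count (inKernel rows) (allVecs n) ≡ 2 ^ (n ∸ rank rows)
count-kernel n rows = ℕP.*-cancelʳ-≡ _ _ (2 ^ rank rows) {{ℕP.m^n≢0 2 (rank rows)}} (begin
  count (inKernel rows) (allVecs n) * 2 ^ rank rows  ≡⟨ kernel-size n rows ⟩
  2 ^ n                                              ≡⟨ cong (2 ^_) (ℕP.m∸n+n≡m (rank≤width n rows)) ⟨
  2 ^ (n ∸ rank rows + rank rows)                    ≡⟨ ℕP.^-distribˡ-+-* 2 (n ∸ rank rows) (rank rows) ⟩
  2 ^ (n ∸ rank rows) * 2 ^ rank rows                ∎)

-- g on a cylinder: kernels of stacked persymmetric matrices

hankel : ∀ {k} → 𝕡 → Vec Bool k → 𝕡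
hankel t Y i = coeffM1 (shift i t) (poly Y)

sum-E-⊗ : ∀ {k} s t (Y : Vec Bool k) → sumℤ (λ Z → E t (poly Y ⊗ poly Z)) (allVecs s) ≡ [ prefixZero s (hankel t Y) ]× 2 ^ s
sum-E-⊗ s t Y = trans (ℤΣ.sum-cong (λ Z → cong sign (coeffM1-⊗ t (poly Y) (poly Z))) (allVecs s)) (sum-E-poly s (hankel t Y))

g≡count : ∀ k s t η ξ → g k s t η ξ ≡
  + (2 ^ s * (2 ^ s * 2 ^ s) * count (λ Y → prefixZero s (hankel t Y) ∧ (prefixZero s (hankel η Y) ∧ prefixZero s (hankel ξ Y))) (allVecs k))
g≡count k s t η ξ = trans
  (ℤΣ.sum-cong (λ Y → begin
      sumℤ (λ Z → E t (poly Y ⊗ poly Z)) (allVecs s) *ℤ (sumℤ (λ U → E η (poly Y ⊗ poly U)) (allVecs s) *ℤ sumℤ (λ V → E ξ (poly Y ⊗ poly V)) (allVecs s))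
        ≡⟨ cong₂ _*ℤ_ (sum-E-⊗ s t Y) (cong₂ _*ℤ_ (sum-E-⊗ s η Y) (sum-E-⊗ s ξ Y)) ⟩
      [ pz t Y ]× 2 ^ s *ℤ ([ pz η Y ]× 2 ^ s *ℤ [ pz ξ Y ]× 2 ^ s)
        ≡⟨ []×-*³ (pz t Y) (pz η Y) (pz ξ Y) (2 ^ s) ⟩
      [ pz t Y ∧ (pz η Y ∧ pz ξ Y) ]× (2 ^ s * (2 ^ s * 2 ^ s)) ∎) (allVecs k))
  (sum-[]× (λ Y → pz t Y ∧ (pz η Y ∧ pz ξ Y)) _ (allVecs k))
  where
  pz : 𝕡 → Vec Bool k → Bool
  pz t Y = prefixZero s (hankel t Y)

prefixZero-cong : ∀ n {t t′ : 𝕡} → (∀ j → t j ≡ t′ j) → prefixZero n t ≡ prefixZero n t′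
prefixZero-cong zero    t≗t′ = refl
prefixZero-cong (suc n) t≗t′ = cong₂ (λ a b → not a ∧ b) (t≗t′ 0) (prefixZero-cong n (λ j → t≗t′ (suc j)))

inKernel-applyUpTo : ∀ {k} n (f : ℕ → Vec Bool k) Y → inKernel (applyUpTo f n) Y ≡ prefixZero n (λ i → dot (f i) Y)
inKernel-applyUpTo zero    f Y = refl
inKernel-applyUpTo (suc n) f Y = cong (not (dot (f 0) Y) ∧_) (inKernel-applyUpTo n (λ i → f (suc i)) Y)

dot-tabulate : ∀ {k} (t : 𝕡) (f : Fin k → Bool) → (∀ j → f j ≡ t (toℕ j)) → ∀ Y → dot (tabulate f) Y ≡ coeffM1 t (toList Y)
dot-tabulate t f f≗t []      = refl
dot-tabulate t f f≗t (y ∷ Y) = begin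
  (f fzero ∧ y) xor dot (tabulate (λ j → f (fsuc j))) Y ≡⟨ cong₂ (λ a b → (a ∧ y) xor b) (f≗t fzero) (dot-tabulate (shift 1 t) _ (λ j → f≗t (fsuc j)) Y) ⟩
  (t 0 ∧ y) xor coeffM1 (shift 1 t) (toList Y)          ≡⟨ coeffM1-∷ t y (toList Y) ⟨
  coeffM1 t (y ∷ toList Y)                              ∎

at-toList : ∀ {N} (a : Vec Bool N) n → at (toList a) n ≡ extend a n
at-toList []      n       = refl
at-toList (x ∷ a) zero    = refl
at-toList (x ∷ a) (suc n) = at-toList a n

inKernel-persym : ∀ s k (a : Vec Bool (s + k ∸ 1)) (Y : Vec Bool k) →
  inKernel (persym s k a) Y ≡ prefixZero s (hankel (extend a) Y)
inKernel-persym s k a Y = begin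
  inKernel (map row (upTo s)) Y                 ≡⟨ cong (λ rows → inKernel rows Y) (ListP.map-upTo row s) ⟩
  inKernel (applyUpTo row s) Y                  ≡⟨ inKernel-applyUpTo s row Y ⟩
  prefixZero s (λ i → dot (row i) Y)            ≡⟨ prefixZero-cong s (λ i → dot-tabulate (shift i (extend a)) _ (λ j → at-toList a (i + toℕ j)) Y) ⟩
  prefixZero s (hankel (extend a) Y)            ∎
  where
  row : ℕ → Vec Bool k
  row i = tabulate (λ j → at (toList a) (i + toℕ j))

-- Grouping the cylinders by rank

sum-upTo-suc : ∀ n (G : ℕ → ℕ) → ℕΣ.sum G (upTo (suc n)) ≡ G 0 + ℕΣ.sum (λ i → G (suc i)) (upTo n)
sum-upTo-suc n G = cong (λ m → G 0 + m) (trans (cong (ℕΣ.sum G) (sym (ListP.map-upTo suc n))) (ℕΣ.sum-map G suc (upTo n)))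

sum-upTo-δ : ∀ n j (G : ℕ → ℕ) → j < n → ℕΣ.sum (λ i → if j ≡ᵇ i then G i else 0) (upTo n) ≡ G j
sum-upTo-δ (suc n) zero    G _         = begin
  ℕΣ.sum (λ i → if 0 ≡ᵇ i then G i else 0) (upTo (suc n))  ≡⟨ sum-upTo-suc n _ ⟩
  G 0 + ℕΣ.sum (λ _ → 0) (upTo n)                           ≡⟨ cong (λ m → G 0 + m) (ℕΣ.sum-0 (upTo n)) ⟩
  G 0 + 0                                                   ≡⟨ ℕP.+-identityʳ (G 0) ⟩
  G 0                                                       ∎
sum-upTo-δ (suc n) (suc j) G (s≤s j<n) = trans (sum-upTo-suc n (λ i → if suc j ≡ᵇ i then G i else 0)) (sum-upTo-δ n j (λ i → G (suc i)) j<n)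

sum-by-value : ∀ {A : Set} (rk : A → ℕ) (F : ℕ → ℕ) n xs → (∀ x → rk x < n) →
  ℕΣ.sum (λ x → F (rk x)) xs ≡ ℕΣ.sum (λ i → count (λ x → rk x ≡ᵇ i) xs * F i) (upTo n)
sum-by-value rk F n xs rk<n = begin
  ℕΣ.sum (λ x → F (rk x)) xs
    ≡⟨ ℕΣ.sum-cong (λ x → sym (sum-upTo-δ n (rk x) F (rk<n x))) xs ⟩
  ℕΣ.sum (λ x → ℕΣ.sum (λ i → if rk x ≡ᵇ i then F i else 0) (upTo n)) xs
    ≡⟨ ℕΣ.sum-comm (λ x i → if rk x ≡ᵇ i then F i else 0) xs (upTo n) ⟩
  ℕΣ.sum (λ i → ℕΣ.sum (λ x → if rk x ≡ᵇ i then F i else 0) xs) (upTo n)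
    ≡⟨ ℕΣ.sum-cong (λ i → ℕΣ.sum-cong (λ x → if≡𝟙* (rk x ≡ᵇ i) (F i)) xs) (upTo n) ⟩
  ℕΣ.sum (λ i → ℕΣ.sum (λ x → 𝟙 (rk x ≡ᵇ i) * F i) xs) (upTo n)
    ≡⟨ ℕΣ.sum-cong (λ i → trans (ℕΣ.sum-*ʳ (F i) (λ x → 𝟙 (rk x ≡ᵇ i)) xs)
                                (cong (_* F i) (sym (count≡sum-𝟙 (λ x → rk x ≡ᵇ i) xs)))) (upTo n) ⟩
  ℕΣ.sum (λ i → count (λ x → rk x ≡ᵇ i) xs * F i) (upTo n) ∎
  where
  if≡𝟙* : ∀ b m → (if b then m else 0) ≡ 𝟙 b * m
  if≡𝟙* true  m = sym (ℕP.+-identityʳ m)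
  if≡𝟙* false m = refl

ℕtoℚ-sum : ∀ {A : Set} (G : A → ℕ) xs → ℕtoℚ (ℕΣ.sum G xs) ≡ sumℚ (λ x → ℕtoℚ (G x)) xs
ℕtoℚ-sum G []       = refl
ℕtoℚ-sum G (x ∷ xs) = trans (ℕtoℚ-+ (G x) _) (cong (ℕtoℚ (G x) +ℚ_) (ℕtoℚ-sum G xs))

+-sum : ∀ {A : Set} (G : A → ℕ) xs → + ℕΣ.sum G xs ≡ sumℤ (λ x → + G x) xs
+-sum G []       = refl
+-sum G (x ∷ xs) = trans (ℤP.pos-+ (G x) _) (cong (+ G x +ℤ_) (+-sum G xs))

+-^ : ∀ m q → (+ m) ^ℤ q ≡ + (m ^ q)
+-^ m zero    = refl
+-^ m (suc q) = trans (cong (+ m *ℤ_) (+-^ m q)) (sym (ℤP.pos-* m (m ^ q)))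

Generators : ℕ → ℕ → Set
Generators s k = Vec Bool (s + k ∸ 1) × Vec Bool (s + k ∸ 1) × Vec Bool (s + k ∸ 1)

allGenerators : ∀ s k → List (Generators s k)
allGenerators s k = concatMap (λ a → concatMap (λ b → map (λ c → a , b , c) Vs) Vs) Vs
  where Vs = allVecs (s + k ∸ 1)

stacked : ∀ s k → Generators s k → List (Vec Bool k)
stacked s k (a , b , c) = persym s k a ++ persym s k b ++ persym s k c

weight : ℕ → ℕ → ℕ → ℕ → ℕ
weight q k s r = 2 ^ ((3 * s + (k ∸ r)) * q)

g-on-cylinder : ∀ s k (abc : Generators s k) → let (a , b , c) = abc in
  g k s (extend a) (extend b) (extend c) ≡ + 2 ^ (3 * s + (k ∸ rank (stacked s k abc)))
g-on-cylinder s k (a , b , c) = begin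
  g k s (extend a) (extend b) (extend c)
    ≡⟨ g≡count k s (extend a) (extend b) (extend c) ⟩
  + (2 ^ s * (2 ^ s * 2 ^ s) * count (λ Y → pz a Y ∧ (pz b Y ∧ pz c Y)) (allVecs k))
    ≡⟨ cong (λ m → + (2 ^ s * (2 ^ s * 2 ^ s) * m)) (count-cong kernel-of-stack (allVecs k)) ⟩
  + (2 ^ s * (2 ^ s * 2 ^ s) * count (inKernel rows) (allVecs k))
    ≡⟨ cong₂ (λ m n → + (m * n)) (2^n³ s) (count-kernel k rows) ⟩
  + (2 ^ (3 * s) * 2 ^ (k ∸ rank rows))
    ≡⟨ cong +_ (ℕP.^-distribˡ-+-* 2 (3 * s) (k ∸ rank rows)) ⟨
  + 2 ^ (3 * s + (k ∸ rank rows)) ∎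
  where
  rows = stacked s k (a , b , c)
  pz : Vec Bool (s + k ∸ 1) → Vec Bool k → Bool
  pz a Y = prefixZero s (hankel (extend a) Y)
  kernel-of-stack : ∀ Y → pz a Y ∧ (pz b Y ∧ pz c Y) ≡ inKernel rows Y
  kernel-of-stack Y = sym (begin
    inKernel (persym s k a ++ persym s k b ++ persym s k c) Y
      ≡⟨ inKernel-++ (persym s k a) _ Y ⟩
    inKernel (persym s k a) Y ∧ inKernel (persym s k b ++ persym s k c) Y
      ≡⟨ cong (inKernel (persym s k a) Y ∧_) (inKernel-++ (persym s k b) (persym s k c) Y) ⟩
    inKernel (persym s k a) Y ∧ (inKernel (persym s k b) Y ∧ inKernel (persym s k c) Y)
      ≡⟨ cong₂ _∧_ (inKernel-persym s k a Y) (cong₂ _∧_ (inKernel-persym s k b Y) (inKernel-persym s k c Y)) ⟩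
    pz a Y ∧ (pz b Y ∧ pz c Y) ∎)

g^q-on-cylinder : ∀ q s k (abc : Generators s k) → let (a , b , c) = abc in
  g k s (extend a) (extend b) (extend c) ^ℤ q ≡ + weight q k s (rank (stacked s k abc))
g^q-on-cylinder q s k abc@(a , b , c) = begin
  g k s (extend a) (extend b) (extend c) ^ℤ q                   ≡⟨ cong (_^ℤ q) (g-on-cylinder s k abc) ⟩
  (+ 2 ^ (3 * s + (k ∸ rank (stacked s k abc)))) ^ℤ q            ≡⟨ +-^ _ q ⟩
  + (2 ^ (3 * s + (k ∸ rank (stacked s k abc)))) ^ q             ≡⟨ cong +_ (ℕP.^-*-assoc 2 (3 * s + (k ∸ rank (stacked s k abc))) q) ⟩
  + weight q k s (rank (stacked s k abc))                        ∎

cylinderSum-persym : ∀ q s k → cylinderSum (s + k ∸ 1) (λ t η ξ → g k s t η ξ ^ℤ q)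
                               ≡ + ℕΣ.sum (λ abc → weight q k s (rank (stacked s k abc))) (allGenerators s k)
cylinderSum-persym q s k = begin
  cylinderSum (s + k ∸ 1) (λ t η ξ → g k s t η ξ ^ℤ q)
    ≡⟨ ℤΣ.sum-cong (λ a → ℤΣ.sum-cong (λ b → ℤΣ.sum-cong (λ c → g^q-on-cylinder q s k (a , b , c)) Vs) Vs) Vs ⟩
  sumℤ (λ a → sumℤ (λ b → sumℤ (λ c → F (a , b , c)) Vs) Vs) Vs
    ≡⟨ ℤΣ.sum-cong (λ a → ℤΣ.sum-cong (λ b → sym (ℤΣ.sum-map F (λ c → a , b , c) Vs)) Vs) Vs ⟩
  sumℤ (λ a → sumℤ (λ b → sumℤ F (map (λ c → a , b , c) Vs)) Vs) Vs
    ≡⟨ ℤΣ.sum-cong (λ a → sym (ℤΣ.sum-concatMap F _ Vs)) Vs ⟩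
  sumℤ (λ a → sumℤ F (concatMap (λ b → map (λ c → a , b , c) Vs) Vs)) Vs
    ≡⟨ ℤΣ.sum-concatMap F _ Vs ⟨
  sumℤ F (allGenerators s k)
    ≡⟨ +-sum (λ abc → weight q k s (rank (stacked s k abc))) (allGenerators s k) ⟨
  + ℕΣ.sum (λ abc → weight q k s (rank (stacked s k abc))) (allGenerators s k) ∎
  where
  Vs = allVecs (s + k ∸ 1)
  F : Generators s k → ℤ
  F abc = + weight q k s (rank (stacked s k abc))

rank-stacked< : ∀ s k (abc : Generators s k) → rank (stacked s k abc) < suc (3 * s ⊓ k)
rank-stacked< s k abc@(a , b , c) = s≤s (ℕP.⊓-glb
  (ℕP.≤-trans (rank≤length k (stacked s k abc)) (ℕP.≤-reflexive (begin
    length (persym s k a ++ persym s k b ++ persym s k c)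
      ≡⟨ ListP.length-++ (persym s k a) ⟩
    length (persym s k a) + length (persym s k b ++ persym s k c)
      ≡⟨ cong (λ m → length (persym s k a) + m) (ListP.length-++ (persym s k b)) ⟩
    length (persym s k a) + (length (persym s k b) + length (persym s k c))
      ≡⟨ cong₂ _+_ (length-persym a) (cong₂ _+_ (length-persym b) (trans (length-persym c) (sym (ℕP.+-identityʳ s)))) ⟩
    3 * s ∎)))
  (rank≤width k (stacked s k abc)))
  where
  length-persym : ∀ a → length (persym s k a) ≡ s
  length-persym a = trans (ListP.length-map _ (upTo s)) (ListP.length-upTo s)

count-false : ∀ {A : Set} (f : A → Bool) xs → (∀ x → f x ≡ false) → count f xs ≡ 0
count-false f []       f≡false = refl
count-false f (x ∷ xs) f≡false rewrite f≡false x = count-false f xs f≡false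

≡ᵇ-< : ∀ m n → m < n → (m ≡ᵇ n) ≡ false
≡ᵇ-< zero    (suc n) _         = refl
≡ᵇ-< (suc m) (suc n) (s≤s m<n) = ≡ᵇ-< m n m<n

Γ-vanishes : ∀ s k i → k < i → Γ s k i ≡ 0
Γ-vanishes s k i k<i = count-false _ (allGenerators s k)
  (λ abc → ≡ᵇ-< _ i (ℕP.≤-<-trans (rank≤width k (stacked s k abc)) k<i))

weight-split : ∀ q k s i → i ≤ k → 2 ^ ((3 * s + k) * q) ≡ weight q k s i * 2 ^ (q * i)
weight-split q k s i i≤k = begin
  2 ^ ((3 * s + k) * q)                         ≡⟨ cong (λ m → 2 ^ ((3 * s + m) * q)) (ℕP.m∸n+n≡m i≤k) ⟨
  2 ^ ((3 * s + (k ∸ i + i)) * q)               ≡⟨ cong (λ m → 2 ^ (m * q)) (ℕP.+-assoc (3 * s) (k ∸ i) i) ⟨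
  2 ^ ((3 * s + (k ∸ i) + i) * q)               ≡⟨ cong (2 ^_) (ℕP.*-distribʳ-+ q (3 * s + (k ∸ i)) i) ⟩
  2 ^ ((3 * s + (k ∸ i)) * q + i * q)           ≡⟨ cong (λ m → 2 ^ ((3 * s + (k ∸ i)) * q + m)) (ℕP.*-comm i q) ⟩
  2 ^ ((3 * s + (k ∸ i)) * q + q * i)           ≡⟨ ℕP.^-distribˡ-+-* 2 ((3 * s + (k ∸ i)) * q) (q * i) ⟩
  weight q k s i * 2 ^ (q * i)                  ∎

ℕtoℚ-2^-*-½^ : ∀ m G e → ℕtoℚ (m * 2 ^ e) *ℚ (ℕtoℚ G *ℚ powℚ ½ e) ≡ ℕtoℚ (G * m)
ℕtoℚ-2^-*-½^ m G e = begin
  ℕtoℚ (m * 2 ^ e) *ℚ (ℕtoℚ G *ℚ powℚ ½ e)          ≡⟨ cong (_*ℚ (ℕtoℚ G *ℚ powℚ ½ e)) (ℕtoℚ-* m (2 ^ e)) ⟩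
  (ℕtoℚ m *ℚ ℕtoℚ (2 ^ e)) *ℚ (ℕtoℚ G *ℚ powℚ ½ e)  ≡⟨ interchange (ℕtoℚ m) (ℕtoℚ (2 ^ e)) (ℕtoℚ G) (powℚ ½ e) ⟩
  (ℕtoℚ m *ℚ ℕtoℚ G) *ℚ (ℕtoℚ (2 ^ e) *ℚ powℚ ½ e)  ≡⟨ cong ((ℕtoℚ m *ℚ ℕtoℚ G) *ℚ_) (trans (ℚP.*-comm (ℕtoℚ (2 ^ e)) (powℚ ½ e)) (½^n*2^n≡1 e)) ⟩
  (ℕtoℚ m *ℚ ℕtoℚ G) *ℚ 1ℚ                          ≡⟨ ℚP.*-identityʳ _ ⟩
  ℕtoℚ m *ℚ ℕtoℚ G                                  ≡⟨ ℕtoℚ-* m G ⟨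
  ℕtoℚ (m * G)                                      ≡⟨ cong ℕtoℚ (ℕP.*-comm m G) ⟩
  ℕtoℚ (G * m)                                      ∎
  where
  open import Algebra.Properties.CommutativeSemigroup (CommutativeMonoid.commutativeSemigroup ℚP.*-1-commutativeMonoid) using (interchange)

Γ-term : ∀ q k s i → ℕtoℚ (2 ^ ((3 * s + k) * q)) *ℚ (ℕtoℚ (Γ s k i) *ℚ powℚ ½ (q * i)) ≡ ℕtoℚ (Γ s k i * weight q k s i)
Γ-term q k s i = by-cases (i ≤? k)
  where
  Goal : ℕ → Set
  Goal G = ℕtoℚ (2 ^ ((3 * s + k) * q)) *ℚ (ℕtoℚ G *ℚ powℚ ½ (q * i)) ≡ ℕtoℚ (G * weight q k s i)
  vanishing : ∀ {G} → G ≡ 0 → Goal G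
  vanishing refl = trans (cong (ℕtoℚ (2 ^ ((3 * s + k) * q)) *ℚ_) (ℚP.*-zeroˡ (powℚ ½ (q * i))))
                         (ℚP.*-zeroʳ (ℕtoℚ (2 ^ ((3 * s + k) * q))))
  by-cases : Dec (i ≤ k) → Goal (Γ s k i)
  by-cases (yes i≤k) = trans (cong (λ m → ℕtoℚ m *ℚ (ℕtoℚ (Γ s k i) *ℚ powℚ ½ (q * i))) (weight-split q k s i i≤k))
                             (ℕtoℚ-2^-*-½^ (weight q k s i) (Γ s k i) (q * i))
  by-cases (no i≰k)  = vanishing (Γ-vanishes s k i (ℕP.≰⇒> i≰k))

3k+3s∸3 : ∀ k s → 3 * k + 3 * s ∸ 3 ≡ 3 * (s + k ∸ 1)
3k+3s∸3 k s = begin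
  3 * k + 3 * s ∸ 3      ≡⟨ cong (_∸ 3) (ℕP.*-distribˡ-+ 3 k s) ⟨
  3 * (k + s) ∸ 3 * 1    ≡⟨ cong (λ m → 3 * m ∸ 3) (ℕP.+-comm k s) ⟩
  3 * (s + k) ∸ 3 * 1    ≡⟨ ℕP.*-distribˡ-∸ 3 (s + k) 1 ⟨
  3 * (s + k ∸ 1)        ∎

R-by-rank : ∀ q k s → let L = suc s + k ∸ 1 in ℕtoℚ (R q k (suc s)) ≡
  powℚ ½ (3 * L) *ℚ ℕtoℚ (ℕΣ.sum (λ i → Γ (suc s) k i * weight q k (suc s) i) (upTo (suc (3 * suc s ⊓ k))))
R-by-rank q k s = begin
  ℕtoℚ (R q k (suc s))
    ≡⟨ R≡integral q k s L (ℕP.≤-reflexive (ℕP.+-comm k s)) ⟩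
  powℚ ½ (3 * L) *ℚ (cylinderSum L (λ t η ξ → g k (suc s) t η ξ ^ℤ q) ℚ./ 1)
    ≡⟨ cong (λ z → powℚ ½ (3 * L) *ℚ (z ℚ./ 1)) (cylinderSum-persym q (suc s) k) ⟩
  powℚ ½ (3 * L) *ℚ ℕtoℚ (ℕΣ.sum (λ abc → weight q k (suc s) (rank (stacked (suc s) k abc))) (allGenerators (suc s) k))
    ≡⟨ cong (λ z → powℚ ½ (3 * L) *ℚ ℕtoℚ z)
            (sum-by-value (λ abc → rank (stacked (suc s) k abc)) (weight q k (suc s)) (suc (3 * suc s ⊓ k))
                          (allGenerators (suc s) k) (rank-stacked< (suc s) k)) ⟩
  powℚ ½ (3 * L) *ℚ ℕtoℚ (ℕΣ.sum (λ i → Γ (suc s) k i * weight q k (suc s) i) (upTo (suc (3 * suc s ⊓ k)))) ∎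
  where
  L = suc s + k ∸ 1

R≡Γ-sum : ∀ q k s → ℕtoℚ (R q k (suc s)) ≡
  (ℕtoℚ (2 ^ ((3 * suc s + k) * q)) *ℚ powℚ ½ (3 * k + 3 * suc s ∸ 3))
    *ℚ sumℚ (λ i → ℕtoℚ (Γ (suc s) k i) *ℚ powℚ ½ (q * i)) (upTo (suc (3 * suc s ⊓ k)))
R≡Γ-sum q k s = begin
  ℕtoℚ (R q k (suc s))
    ≡⟨ R-by-rank q k s ⟩
  powℚ ½ (3 * L) *ℚ ℕtoℚ (ℕΣ.sum (λ i → Γ (suc s) k i * weight q k (suc s) i) is)
    ≡⟨ cong (powℚ ½ (3 * L) *ℚ_) (ℕtoℚ-sum (λ i → Γ (suc s) k i * weight q k (suc s) i) is) ⟩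
  powℚ ½ (3 * L) *ℚ sumℚ (λ i → ℕtoℚ (Γ (suc s) k i * weight q k (suc s) i)) is
    ≡⟨ cong (powℚ ½ (3 * L) *ℚ_) (ℚΣ.sum-cong (λ i → sym (Γ-term q k (suc s) i)) is) ⟩
  powℚ ½ (3 * L) *ℚ sumℚ (λ i → X *ℚ h i) is
    ≡⟨ cong (powℚ ½ (3 * L) *ℚ_) (ℚΣ.sum-*ˡ X h is) ⟩
  powℚ ½ (3 * L) *ℚ (X *ℚ sumℚ h is)
    ≡⟨ ℚP.*-assoc (powℚ ½ (3 * L)) X (sumℚ h is) ⟨
  (powℚ ½ (3 * L) *ℚ X) *ℚ sumℚ h is
    ≡⟨ cong (_*ℚ sumℚ h is) (ℚP.*-comm (powℚ ½ (3 * L)) X) ⟩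
  (X *ℚ powℚ ½ (3 * L)) *ℚ sumℚ h is
    ≡⟨ cong (λ e → (X *ℚ powℚ ½ e) *ℚ sumℚ h is) (3k+3s∸3 k (suc s)) ⟨
  (X *ℚ powℚ ½ (3 * k + 3 * suc s ∸ 3)) *ℚ sumℚ h is ∎
  where
  L = suc s + k ∸ 1
  is = upTo (suc (3 * suc s ⊓ k))
  X = ℕtoℚ (2 ^ ((3 * suc s + k) * q))
  h : ℕ → ℚ
  h i = ℕtoℚ (Γ (suc s) k i) *ℚ powℚ ½ (q * i)

theorem3p4 : (q k s : ℕ) → 1 ≤ k → 1 ≤ s →
    ((N : ℕ) → k + s ∸ 1 ≤ N →
      ℕtoℚ (R q k s) ≡ integral3 N (λ t η ξ → g k s t η ξ ^ℤ q))
    × (ℕtoℚ (R q k s) ≡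
        (ℕtoℚ (2 ^ ((3 * s + k) * q)) *ℚ powℚ ½ (3 * k + 3 * s ∸ 3))
          *ℚ sumℚ (λ i → ℕtoℚ (Γ s k i) *ℚ powℚ ½ (q * i)) (upTo (suc (3 * s ⊓ k))))
theorem3p4 q k (suc s) _ (s≤s z≤n) =
  (λ N k+s≤N → R≡integral q k s N (subst (_≤ N) (cong (_∸ 1) (ℕP.+-suc k s)) k+s≤N)) , R≡Γ-sum q k s
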